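{- Let $\mathcal{L}$ be a finite algebraic language, $\mathcal{V}$ an equational class of $\mathcal{L}$-algebras, $\Sigma\cup\Delta$ a finite set of $\mathcal{L}$-identities, and $X\supseteq\mathrm{Var}(\Sigma\cup\Delta)$ a finite set of variables. If $S$ is a complete set for the preordered set $\mathsf{E}_{\mathcal{V}}(\Sigma,X)$, then the following are equivalent: (i) the clause $\Sigma\Rightarrow\Delta$ is $\mathcal{V}$-admissible; (ii) each $\sigma\in S$ is a $\mathcal{V}$-unifier of some $\varphi\approx\psi\in\Delta$; (iii) for each $\sigma\in S$, $\Delta\cap\ker(h_{\mathcal{V}}\circ\sigma)\neq\emptyset$.
   Context: $\mathbf{Fm}_{\mathcal{L}}(Y)$ is the formula algebra over variables $Y$, $\omega$ a countably infinite set of variables, $\mathrm{Var}(\Sigma)$ the set of variables occurring in $\Sigma$; identities are identified with pairs of formulas. $h_{\mathcal{V}}\colon\mathbf{Fm}_{\mathcal{L}}(Y)\to\mathbf{F}_{\mathcal{V}}(Y)$ is the canonical homomorphism onto the free algebra of $\mathcal{V}$, and $\ker(h)=\{(a,b)\mid h(a)=h(b)\}$. A substitution (homomorphism) $\sigma\colon\mathbf{Fm}_{\mathcal{L}}(X)\to\mathbf{Fm}_{\mathcal{L}}(\omega)$ is a $\mathcal{V}$-unifier of a set $\Sigma$ of identities (with $\mathrm{Var}(\Sigma)\subseteq X$) if $\mathcal{V}\models\sigma(\varphi)\approx\sigma(\psi)$ for all $\varphi\approx\psi\in\Sigma$. A clause $\Sigma\Rightarrow\Delta$ (pair of finite sets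 of identities) is $\mathcal{V}$-admissible if every substitution $\sigma\colon\mathbf{Fm}_{\mathcal{L}}(\mathrm{Var}(\Sigma\cup\Delta))\to\mathbf{Fm}_{\mathcal{L}}(\omega)$ that $\mathcal{V}$-unifies $\Sigma$ also $\mathcal{V}$-unifies some member of $\Delta$. $\mathsf{E}_{\mathcal{V}}(\Sigma,X)$ is the set of $\mathcal{V}$-unifiers of $\Sigma$ over $X$ preordered by $\sigma_2\sqsubseteq_{\mathcal{V}}\sigma_1$ iff $\ker(h_{\mathcal{V}}\circ\sigma_1)\subseteq\ker(h_{\mathcal{V}}\circ\sigma_2)$. In a preordered set $(P,\le)$, a complete set is $M\subseteq P$ such that for every $x\in P$ there is $y\in M$ with $x\le y$. -}

module Defs where

open import Data.Nat using (ℕ)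
open import Data.Fin using (Fin)
open import Data.Product using (Σ; _×_; _,_; proj₁; proj₂; Σ-syntax)
open import Data.List using (List; _++_)
open import Data.List.Membership.Propositional using (_∈_)
open import Data.List.Relation.Unary.All using (All)
open import Relation.Binary.PropositionalEquality using (_≡_)
open import Level using (Level) renaming (suc to lsuc; zero to lzero)

record Language : Set where
  field
    nOps  : ℕ
    arity : Fin nOps → ℕ
open Language public

data Term (L : Language) : Set where
  var : ℕ → Term L
  op  : (f : Fin (nOps L)) → (Fin (arity L f) → Term L) → Term L

Identity : Language → Set
Identity L = Term L × Term L

data VarsIn {L : Language} (X : List ℕ) : Term L → Set where
  var : ∀ {x} → x ∈ X → VarsIn X (var x)
  op  : ∀ {f ts} → (∀ i → VarsIn X (ts i)) → VarsIn X (op f ts)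

IdVarsIn : {L : Language} → List ℕ → Identity L → Set
IdVarsIn X (s , t) = VarsIn X s × VarsIn X t

-- Substitutions (homomorphisms Fm → Fm(ω)), given by their action on variables.
Subst : Language → Set
Subst L = ℕ → Term L

_⟦_⟧ : {L : Language} → Subst L → Term L → Term L
σ ⟦ var x ⟧ = σ x
σ ⟦ op f ts ⟧ = op f (λ i → σ ⟦ ts i ⟧)

record Algebra (L : Language) : Set₁ where
  field
    Carrier : Set
    interp  : (f : Fin (nOps L)) → (Fin (arity L f) → Carrier) → Carrier
open Algebra public

eval : {L : Language} (A : Algebra L) → (ℕ → Carrier A) → Term L → Carrier A
eval A v (var x) = v x
eval A v (op f ts) = interp A f (λ i → eval A v (ts i))

_⊨ᴬ_ : {L : Language} → Algebra L → Identity L → Set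
A ⊨ᴬ (s , t) = ∀ (v : ℕ → Carrier A) → eval A v s ≡ eval A v t

-- An equational class V is given by a defining set of identities E:
-- V = Mod(E).  V ⊨ s ≈ t  means every algebra in V satisfies s ≈ t.
EqTheory : Language → Set₁
EqTheory L = Identity L → Set

_⊨_ : {L : Language} → EqTheory L → Identity L → Set₁
_⊨_ {L} E e = (A : Algebra L) → (∀ d → E d → A ⊨ᴬ d) → A ⊨ᴬ e

UnifiesId : {L : Language} → EqTheory L → Subst L → Identity L → Set₁
UnifiesId E σ (s , t) = E ⊨ ((σ ⟦ s ⟧) , (σ ⟦ t ⟧))

Unifier : {L : Language} → EqTheory L → List (Identity L) → Subst L → Set₁
Unifier E Γ σ = ∀ e → e ∈ Γ → UnifiesId E σ e

-- ker(h_V ∘ σ) for σ : Fm(X) → Fm(ω): pairs (a,b) of formulas over X with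
-- h_V(σ a) = h_V(σ b), i.e. V ⊨ σ a ≈ σ b.
Ker : {L : Language} → EqTheory L → List ℕ → Subst L → Identity L → Set₁
Ker E X σ (a , b) = IdVarsIn X (a , b) × E ⊨ ((σ ⟦ a ⟧) , (σ ⟦ b ⟧))

_⊑[_,_]_ : {L : Language} → Subst L → EqTheory L → List ℕ → Subst L → Set₁
σ₂ ⊑[ E , X ] σ₁ = ∀ e → Ker E X σ₁ e → Ker E X σ₂ e

CompleteSet : {L : Language} → EqTheory L → List (Identity L) → List ℕ
            → (Subst L → Set₁) → Set₁
CompleteSet E Γ X S =
  (∀ σ → S σ → Unifier E Γ σ) ×
  (∀ σ → Unifier E Γ σ → Σ[ τ ∈ Subst _ ] (S τ × σ ⊑[ E , X ] τ))

Admissible : {L : Language} → EqTheory L → List (Identity L) → List (Identity L) → Set₁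
Admissible E Γ Δ = ∀ σ → Unifier E Γ σ → Σ[ e ∈ Identity _ ] (e ∈ Δ × UnifiesId E σ e)

-- (i) ⇒ (ii) because members of a complete set are unifiers of Σ, and (ii) ⇒ (iii)
-- because the identities of Δ have their variables in X.  For (iii) ⇒ (i), an
-- arbitrary unifier lies below some τ ∈ S, so its kernel contains ker(h ∘ τ), which
-- meets Δ.
module Submission where

open import Defs
open import Data.Nat using (ℕ)
open import Data.Product using (Σ; _×_; _,_; Σ-syntax)
open import Data.List using (List; _++_)
open import Data.List.Membership.Propositional using (_∈_)
open import Data.List.Relation.Unary.All using (All; lookup)
open import Data.List.Relation.Unary.All.Properties using (++⁻ʳ)

module _ {L : Language} (E : EqTheory L) where

  UnifiesSome : List (Identity L) → Subst L → Set₁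
  UnifiesSome Δ σ = Σ[ e ∈ Identity L ] (e ∈ Δ × UnifiesId E σ e)

  KerMeets : List ℕ → List (Identity L) → Subst L → Set₁
  KerMeets X Δ σ = Σ[ e ∈ Identity L ] (e ∈ Δ × Ker E X σ e)

  unifiesSome⇒kerMeets : ∀ {X Δ σ} → All (IdVarsIn X) Δ → UnifiesSome Δ σ → KerMeets X Δ σ
  unifiesSome⇒kerMeets Δ⊆X (e , e∈Δ , unifies) =
    e , e∈Δ , lookup Δ⊆X e∈Δ , unifies

  ⊑-kerMeets : ∀ {X Δ σ τ} → σ ⊑[ E , X ] τ → KerMeets X Δ τ → KerMeets X Δ σ
  ⊑-kerMeets σ⊑τ (e , e∈Δ , inKer) = e , e∈Δ , σ⊑τ e inKer

  kerMeets⇒admissible : ∀ {Γ Δ X} (S : Subst L → Set₁) → CompleteSet E Γ X S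
    → (∀ σ → S σ → KerMeets X Δ σ) → Admissible E Γ Δ
  kerMeets⇒admissible S (_ , dominated) meets σ unifiesΓ =
    let (τ , τ∈S , σ⊑τ) = dominated σ unifiesΓ
        (e , e∈Δ , _ , unifies) = ⊑-kerMeets σ⊑τ (meets τ τ∈S)
    in e , e∈Δ , unifies

corollary3p2 : (L : Language) (E : EqTheory L) (Γ Δ : List (Identity L)) (X : List ℕ)
    → All (IdVarsIn X) (Γ ++ Δ)
    → (S : Subst L → Set₁) → CompleteSet E Γ X S
    → (Admissible E Γ Δ
         → ∀ σ → S σ → Σ[ e ∈ Identity L ] (e ∈ Δ × UnifiesId E σ e))
      × ((∀ σ → S σ → Σ[ e ∈ Identity L ] (e ∈ Δ × UnifiesId E σ e))
         → ∀ σ → S σ → Σ[ e ∈ Identity L ] (e ∈ Δ × Ker E X σ e))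
      × ((∀ σ → S σ → Σ[ e ∈ Identity L ] (e ∈ Δ × Ker E X σ e))
         → Admissible E Γ Δ)
corollary3p2 L E Γ Δ X Γ++Δ⊆X S complete@(S-unifies , _) =
  (λ admissible σ σ∈S → admissible σ (S-unifies σ σ∈S)) ,
  (λ unifies σ σ∈S → unifiesSome⇒kerMeets E (++⁻ʳ Γ Γ++Δ⊆X) (unifies σ σ∈S)) ,
  kerMeets⇒admissible E S complete
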